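{- Let $M,M',N,N'$ be terms of $\lambda^{Sym}_{Prop}$. (1) If $M\sim M'$ and $N\sim N'$, then $M[x:=N]\sim M'[x:=N']$. (2) If $M\sim M'$ and $M'\to N$, then there is a term $N'$ such that $M\to N'$ and $N\sim N'$.
   Context: Terms of $\lambda^{Sym}_{Prop}$ are built from variables by $\langle P_1,P_2\rangle$, $\sigma_i(P)$ ($i=1,2$), $\lambda xP$, $(P_1\star P_2)$, with the typing: $\Gamma,x:A\vdash x:A$; $\langle P_1,P_2\rangle:A_1\wedge A_2$; $\sigma_i(P_i):A_1\vee A_2$; $\lambda xP:A^\bot$ from $\Gamma,x:A\vdash P:\bot$; $(P_1\star P_2):\bot$ from $P_1:A^\bot,P_2:A$ (m-types $A::=\alpha\mid\alpha^\bot\mid A\wedge A\mid A\vee A$, involutive negation $(A\wedge B)^\bot=A^\bot\vee B^\bot$, $(A\vee B)^\bot=A^\bot\wedge B^\bot$, $(\alpha^\bot)^\bot=\alpha$; types are m-types and $\bot$). $\to$ is the compatible closure of: $(\lambda xP\star Q)\to P[x:=Q]$; $(Q\star\lambda xP)\to P[x:=Q]$; $\lambda x(P\star x)\to P$ and $\lambda x(x\star P)\to P$ if $x\notin Fv(P)$; $(\langle P_1,P_2\rangle\star\sigma_i(Q))\to(P_i\star Q)$; $(\sigma_i(Q)\star\langle P_1,P_2\rangle)\to(Q\star P_i)$; $E[P]\to P$ whenever $E[-]\neq[-]$ is a one-hole context with $E[P]:\bot$, $P:\bot$ and $E$ binding no free variable of $P$. The relation $\sim$ ("equal up to symmetry")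 is the smallest relation such that: $x\sim x$; if $M\sim M'$ then $\lambda xM\sim\lambda xM'$ and $\sigma_i(M)\sim\sigma_i(M')$; if $M\sim M'$ and $N\sim N'$ then $\langle M,N\rangle\sim\langle M',N'\rangle$, $(M\star N)\sim(M'\star N')$ and $(M\star N)\sim(N'\star M')$. -}

module Defs where

open import Data.Nat using (ℕ; zero; suc; _+_; _≟_)
open import Data.List using (List; []; _∷_)
open import Data.Product using (Σ; _×_; _,_)
open import Relation.Nullary using (¬_; yes; no)
open import Relation.Binary.PropositionalEquality using (_≡_)

data MType : Set where
  atom    : ℕ → MType
  atom⊥   : ℕ → MType
  _∧_     : MType → MType → MType
  _∨_     : MType → MType → MType

_ᗮ : MType → MType
atom a ᗮ  = atom⊥ a
atom⊥ a ᗮ = atom a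
(A ∧ B) ᗮ = (A ᗮ) ∨ (B ᗮ)
(A ∨ B) ᗮ = (A ᗮ) ∧ (B ᗮ)

data Ty : Set where
  m  : MType → Ty
  ⊥ₜ : Ty

-- Raw terms, de Bruijn indices (var 0 = innermost bound variable)

data Side : Set where
  𝟏 𝟐 : Side

data Term : Set where
  var  : ℕ → Term
  ⟨_,_⟩ : Term → Term → Term
  σ    : Side → Term → Term
  ƛ    : Term → Term
  _⋆_  : Term → Term → Term

infixl 5 _⋆_

select : {X : Set} → Side → X → X → X
select 𝟏 a b = a
select 𝟐 a b = b

ext : (ℕ → ℕ) → ℕ → ℕ
ext ρ zero    = zero
ext ρ (suc i) = suc (ρ i)

rename : (ℕ → ℕ) → Term → Term
rename ρ (var i)     = var (ρ i)
rename ρ ⟨ P , Q ⟩   = ⟨ rename ρ P , rename ρ Q ⟩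
rename ρ (σ i P)     = σ i (rename ρ P)
rename ρ (ƛ P)       = ƛ (rename (ext ρ) P)
rename ρ (P ⋆ Q)     = rename ρ P ⋆ rename ρ Q

-- shift k P : P viewed underneath k fresh binders (which it does not use)
shift : ℕ → Term → Term
shift k = rename (k +_)

exts : (ℕ → Term) → ℕ → Term
exts s zero    = var zero
exts s (suc i) = rename suc (s i)

subst : (ℕ → Term) → Term → Term
subst s (var i)     = s i
subst s ⟨ P , Q ⟩   = ⟨ subst s P , subst s Q ⟩
subst s (σ i P)     = σ i (subst s P)
subst s (ƛ P)       = ƛ (subst (exts s) P)
subst s (P ⋆ Q)     = subst s P ⋆ subst s Q

-- M [ x := N ] : replace the free variable x by N (all other free
-- variables unchanged), as in the named presentation.
_[_:=_] : Term → ℕ → Term → Term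
M [ x := N ] = subst s M
  where
  s : ℕ → Term
  s y with y ≟ x
  ... | yes _ = N
  ... | no  _ = var y

-- β-substitution: P [x := Q] for the variable x bound by ƛ (index 0),
-- P's other free variables are lowered by one.
_[0:=_] : Term → Term → Term
P [0:= Q ] = subst s P
  where
  s : ℕ → Term
  s zero    = Q
  s (suc i) = var i

-- Typing  Γ ⊢ P : T   (Curry style; Γ lists the types of var 0, var 1, …)

Cx : Set
Cx = List MType

data _∋_∶_ : Cx → ℕ → MType → Set where
  here  : ∀ {Γ A} → (A ∷ Γ) ∋ zero ∶ A
  there : ∀ {Γ A B i} → Γ ∋ i ∶ A → (B ∷ Γ) ∋ suc i ∶ A

data _⊢_∶_ : Cx → Term → Ty → Set where
  ⊢var  : ∀ {Γ i A} → Γ ∋ i ∶ A → Γ ⊢ var i ∶ m A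
  ⊢pair : ∀ {Γ P₁ P₂ A₁ A₂} → Γ ⊢ P₁ ∶ m A₁ → Γ ⊢ P₂ ∶ m A₂ →
          Γ ⊢ ⟨ P₁ , P₂ ⟩ ∶ m (A₁ ∧ A₂)
  ⊢σ₁   : ∀ {Γ P A₁ A₂} → Γ ⊢ P ∶ m A₁ → Γ ⊢ σ 𝟏 P ∶ m (A₁ ∨ A₂)
  ⊢σ₂   : ∀ {Γ P A₁ A₂} → Γ ⊢ P ∶ m A₂ → Γ ⊢ σ 𝟐 P ∶ m (A₁ ∨ A₂)
  ⊢ƛ    : ∀ {Γ P A} → (A ∷ Γ) ⊢ P ∶ ⊥ₜ → Γ ⊢ ƛ P ∶ m (A ᗮ)
  ⊢⋆    : ∀ {Γ P₁ P₂ A} → Γ ⊢ P₁ ∶ m (A ᗮ) → Γ ⊢ P₂ ∶ m A →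
          Γ ⊢ P₁ ⋆ P₂ ∶ ⊥ₜ

data Ctx : Set where
  □     : Ctx
  ⟨_,-⟩ : Ctx → Term → Ctx
  ⟨-,_⟩ : Term → Ctx → Ctx
  σᶜ    : Side → Ctx → Ctx
  ƛᶜ    : Ctx → Ctx
  _⋆ᶜ_  : Ctx → Term → Ctx
  _ᶜ⋆_  : Term → Ctx → Ctx

plug : Ctx → Term → Term
plug □ P            = P
plug (⟨ E ,-⟩ Q) P  = ⟨ plug E P , Q ⟩
plug (⟨-, Q ⟩ E) P  = ⟨ Q , plug E P ⟩
plug (σᶜ i E) P     = σ i (plug E P)
plug (ƛᶜ E) P       = ƛ (plug E P)
plug (E ⋆ᶜ Q) P     = plug E P ⋆ Q
plug (Q ᶜ⋆ E) P     = Q ⋆ plug E P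

binders : Ctx → ℕ
binders □            = zero
binders (⟨ E ,-⟩ Q)  = binders E
binders (⟨-, Q ⟩ E)  = binders E
binders (σᶜ i E)     = binders E
binders (ƛᶜ E)       = suc (binders E)
binders (E ⋆ᶜ Q)     = binders E
binders (Q ᶜ⋆ E)     = binders E

data _⟶_ : Term → Term → Set where
  βl   : ∀ {P Q} → (ƛ P ⋆ Q) ⟶ (P [0:= Q ])
  βr   : ∀ {P Q} → (Q ⋆ ƛ P) ⟶ (P [0:= Q ])
  -- λx(P ⋆ x) → P and λx(x ⋆ P) → P with x ∉ Fv(P)
  ηl   : ∀ {P} → ƛ (shift 1 P ⋆ var zero) ⟶ P
  ηr   : ∀ {P} → ƛ (var zero ⋆ shift 1 P) ⟶ P
  πl   : ∀ {i P₁ P₂ Q} → (⟨ P₁ , P₂ ⟩ ⋆ σ i Q) ⟶ (select i P₁ P₂ ⋆ Q)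
  πr   : ∀ {i P₁ P₂ Q} → (σ i Q ⋆ ⟨ P₁ , P₂ ⟩) ⟶ (Q ⋆ select i P₁ P₂)
  -- E[P] → P  for E ≠ [-], E[P] : ⊥, P : ⊥, E binding no free variable of P
  ctx  : ∀ {E P Γ} → ¬ (E ≡ □) →
         Γ ⊢ plug E (shift (binders E) P) ∶ ⊥ₜ → Γ ⊢ P ∶ ⊥ₜ →
         plug E (shift (binders E) P) ⟶ P
  c-pairˡ : ∀ {P P' Q} → P ⟶ P' → ⟨ P , Q ⟩ ⟶ ⟨ P' , Q ⟩
  c-pairʳ : ∀ {P Q Q'} → Q ⟶ Q' → ⟨ P , Q ⟩ ⟶ ⟨ P , Q' ⟩
  c-σ     : ∀ {i P P'} → P ⟶ P' → σ i P ⟶ σ i P'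
  c-ƛ     : ∀ {P P'} → P ⟶ P' → ƛ P ⟶ ƛ P'
  c-⋆ˡ    : ∀ {P P' Q} → P ⟶ P' → (P ⋆ Q) ⟶ (P' ⋆ Q)
  c-⋆ʳ    : ∀ {P Q Q'} → Q ⟶ Q' → (P ⋆ Q) ⟶ (P ⋆ Q')

data _∼_ : Term → Term → Set where
  ∼var  : ∀ {x} → var x ∼ var x
  ∼ƛ    : ∀ {M M'} → M ∼ M' → ƛ M ∼ ƛ M'
  ∼σ    : ∀ {i M M'} → M ∼ M' → σ i M ∼ σ i M'
  ∼pair : ∀ {M M' N N'} → M ∼ M' → N ∼ N' → ⟨ M , N ⟩ ∼ ⟨ M' , N' ⟩
  ∼⋆    : ∀ {M M' N N'} → M ∼ M' → N ∼ N' → (M ⋆ N) ∼ (M' ⋆ N')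
  ∼⋆sym : ∀ {M M' N N'} → M ∼ M' → N ∼ N' → (M ⋆ N) ∼ (N' ⋆ M')

module Submission where

-- (1) Comparing substitutions pointwise, ∼ is preserved by renaming,
--     hence by lifting a substitution under a binder, hence by
--     simultaneous substitution; M [ x := N ] and the β-substitution
--     P [0:= Q ] are special cases.
-- (2) Conversely, ∼ reflects the shape of renamings and of plugged
--     contexts: a term similar to rename ρ P (resp. plug E Q) is itself
--     of that form, up to ∼ on P (resp. Q).  Moreover ∼ preserves
--     typing.  With these facts every root rule of ⟶ (β, η, π and the
--     context-erasing rule E[P] → P) is simulated case by case, and the
--     compatible closure is handled by structural recursion.  Symmetry
--     of ∼ then turns the simulation into the form stated.

open import Defs
open import Data.Nat using (ℕ; zero; suc; _+_; _≟_)
open import Data.Product using (Σ; _×_; _,_)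
open import Relation.Nullary using (¬_; yes; no)
open import Relation.Binary.PropositionalEquality
  using (_≡_; refl; sym; cong; cong₂) renaming (subst to transport)

∼sym : ∀ {M M'} → M ∼ M' → M' ∼ M
∼sym ∼var         = ∼var
∼sym (∼ƛ p)       = ∼ƛ (∼sym p)
∼sym (∼σ p)       = ∼σ (∼sym p)
∼sym (∼pair p q)  = ∼pair (∼sym p) (∼sym q)
∼sym (∼⋆ p q)     = ∼⋆ (∼sym p) (∼sym q)
∼sym (∼⋆sym p q)  = ∼⋆sym (∼sym q) (∼sym p)

_∼ˢ_ : (ℕ → Term) → (ℕ → Term) → Set
s ∼ˢ s' = ∀ i → s i ∼ s' i

rename-cong : ∀ ρ {M M'} → M ∼ M' → rename ρ M ∼ rename ρ M'
rename-cong ρ ∼var         = ∼var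
rename-cong ρ (∼ƛ p)       = ∼ƛ (rename-cong (ext ρ) p)
rename-cong ρ (∼σ p)       = ∼σ (rename-cong ρ p)
rename-cong ρ (∼pair p q)  = ∼pair (rename-cong ρ p) (rename-cong ρ q)
rename-cong ρ (∼⋆ p q)     = ∼⋆ (rename-cong ρ p) (rename-cong ρ q)
rename-cong ρ (∼⋆sym p q)  = ∼⋆sym (rename-cong ρ p) (rename-cong ρ q)

exts-cong : ∀ {s s'} → s ∼ˢ s' → exts s ∼ˢ exts s'
exts-cong h zero    = ∼var
exts-cong h (suc i) = rename-cong suc (h i)

subst-cong : ∀ {s s'} → s ∼ˢ s' → ∀ {M M'} → M ∼ M' → subst s M ∼ subst s' M'
subst-cong h (∼var {x})   = h x
subst-cong h (∼ƛ p)       = ∼ƛ (subst-cong (exts-cong h) p)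
subst-cong h (∼σ p)       = ∼σ (subst-cong h p)
subst-cong h (∼pair p q)  = ∼pair (subst-cong h p) (subst-cong h q)
subst-cong h (∼⋆ p q)     = ∼⋆ (subst-cong h p) (subst-cong h q)
subst-cong h (∼⋆sym p q)  = ∼⋆sym (subst-cong h p) (subst-cong h q)

:=-cong : ∀ x {N N'} → N ∼ N' → ∀ y → (var y [ x := N ]) ∼ (var y [ x := N' ])
:=-cong x q y with y ≟ x
... | yes _ = q
... | no  _ = ∼var

β-subst-cong : ∀ {P P' Q Q'} → P ∼ P' → Q ∼ Q' → (P [0:= Q ]) ∼ (P' [0:= Q' ])
β-subst-cong p q = subst-cong 0:=-cong p
  where
  0:=-cong : ∀ i → (var i [0:= _ ]) ∼ (var i [0:= _ ])
  0:=-cong zero    = q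
  0:=-cong (suc i) = ∼var

rename-reflect : ∀ ρ P {K} → K ∼ rename ρ P →
                 Σ Term (λ P₀ → (K ≡ rename ρ P₀) × (P₀ ∼ P))
rename-reflect ρ (var i) ∼var = var i , refl , ∼var
rename-reflect ρ ⟨ P , Q ⟩ (∼pair p q)
  with rename-reflect ρ P p | rename-reflect ρ Q q
... | P₀ , refl , a | Q₀ , refl , b = ⟨ P₀ , Q₀ ⟩ , refl , ∼pair a b
rename-reflect ρ (σ i P) (∼σ p) with rename-reflect ρ P p
... | P₀ , refl , a = σ i P₀ , refl , ∼σ a
rename-reflect ρ (ƛ P) (∼ƛ p) with rename-reflect (ext ρ) P p
... | P₀ , refl , a = ƛ P₀ , refl , ∼ƛ a
rename-reflect ρ (P ⋆ Q) (∼⋆ p q) with rename-reflect ρ P p | rename-reflect ρ Q q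
... | P₀ , refl , a | Q₀ , refl , b = P₀ ⋆ Q₀ , refl , ∼⋆ a b
rename-reflect ρ (P ⋆ Q) (∼⋆sym p q) with rename-reflect ρ Q p | rename-reflect ρ P q
... | Q₀ , refl , a | P₀ , refl , b = Q₀ ⋆ P₀ , refl , ∼⋆sym a b

-- A term similar to E[Q] is E'[Q₀] with Q₀ ∼ Q, where E' is E with some
-- ⋆-nodes mirrored: it has the same binders and is non-trivial iff E is.
record PlugReflect (E : Ctx) (Q M : Term) : Set where
  constructor plugged
  field
    E'           : Ctx
    Q₀           : Term
    M≡E'[Q₀]     : M ≡ plug E' Q₀
    Q₀∼Q         : Q₀ ∼ Q
    same-binders : binders E' ≡ binders E
    nontrivial   : ¬ E ≡ □ → ¬ E' ≡ □

plug-reflect : ∀ E Q {M} → M ∼ plug E Q → PlugReflect E Q M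
plug-reflect □ Q {M} p = plugged □ M refl p refl (λ E≢□ _ → E≢□ refl)
plug-reflect (⟨ E ,-⟩ R) Q (∼pair {N = B} p q) with plug-reflect E Q p
... | plugged E' Q₀ refl a b _ = plugged (⟨ E' ,-⟩ B) Q₀ refl a b (λ _ ())
plug-reflect (⟨-, R ⟩ E) Q (∼pair {M = A} p q) with plug-reflect E Q q
... | plugged E' Q₀ refl a b _ = plugged (⟨-, A ⟩ E') Q₀ refl a b (λ _ ())
plug-reflect (σᶜ i E) Q (∼σ p) with plug-reflect E Q p
... | plugged E' Q₀ refl a b _ = plugged (σᶜ i E') Q₀ refl a b (λ _ ())
plug-reflect (ƛᶜ E) Q (∼ƛ p) with plug-reflect E Q p
... | plugged E' Q₀ refl a b _ = plugged (ƛᶜ E') Q₀ refl a (cong suc b) (λ _ ())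
plug-reflect (E ⋆ᶜ R) Q (∼⋆ {N = B} p q) with plug-reflect E Q p
... | plugged E' Q₀ refl a b _ = plugged (E' ⋆ᶜ B) Q₀ refl a b (λ _ ())
plug-reflect (E ⋆ᶜ R) Q (∼⋆sym {M = A} p q) with plug-reflect E Q q
... | plugged E' Q₀ refl a b _ = plugged (A ᶜ⋆ E') Q₀ refl a b (λ _ ())
plug-reflect (R ᶜ⋆ E) Q (∼⋆ {M = A} p q) with plug-reflect E Q q
... | plugged E' Q₀ refl a b _ = plugged (A ᶜ⋆ E') Q₀ refl a b (λ _ ())
plug-reflect (R ᶜ⋆ E) Q (∼⋆sym {N = B} p q) with plug-reflect E Q p
... | plugged E' Q₀ refl a b _ = plugged (E' ⋆ᶜ B) Q₀ refl a b (λ _ ())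

ᗮ-involutive : ∀ A → (A ᗮ) ᗮ ≡ A
ᗮ-involutive (atom a)  = refl
ᗮ-involutive (atom⊥ a) = refl
ᗮ-involutive (A ∧ B)   = cong₂ _∧_ (ᗮ-involutive A) (ᗮ-involutive B)
ᗮ-involutive (A ∨ B)   = cong₂ _∨_ (ᗮ-involutive A) (ᗮ-involutive B)

-- Similar terms have the same types; swapping a cut P ⋆ Q at A into
-- Q ⋆ P is a cut at A ᗮ, which is well typed because ᗮ is involutive.
∼-preserves-typing : ∀ {Γ M M' T} → M ∼ M' → Γ ⊢ M ∶ T → Γ ⊢ M' ∶ T
∼-preserves-typing ∼var t = t
∼-preserves-typing (∼ƛ p) (⊢ƛ t) = ⊢ƛ (∼-preserves-typing p t)
∼-preserves-typing (∼σ p) (⊢σ₁ t) = ⊢σ₁ (∼-preserves-typing p t)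
∼-preserves-typing (∼σ p) (⊢σ₂ t) = ⊢σ₂ (∼-preserves-typing p t)
∼-preserves-typing (∼pair p q) (⊢pair t u) =
  ⊢pair (∼-preserves-typing p t) (∼-preserves-typing q u)
∼-preserves-typing (∼⋆ p q) (⊢⋆ t u) =
  ⊢⋆ (∼-preserves-typing p t) (∼-preserves-typing q u)
∼-preserves-typing {Γ} (∼⋆sym p q) (⊢⋆ {A = A} t u) =
  ⊢⋆ {A = A ᗮ}
     (transport (λ B → Γ ⊢ _ ∶ m B) (sym (ᗮ-involutive A)) (∼-preserves-typing q u))
     (∼-preserves-typing p t)

_⟶∼_ : Term → Term → Set
M ⟶∼ N = Σ Term (λ N' → (M ⟶ N') × (N' ∼ N))

select-cong : ∀ i {A A' B B'} → A ∼ A' → B ∼ B' → select i A B ∼ select i A' B'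
select-cong 𝟏 p q = p
select-cong 𝟐 p q = q

simulate-βl : ∀ {M P Q} → M ∼ (ƛ P ⋆ Q) → M ⟶∼ (P [0:= Q ])
simulate-βl (∼⋆ (∼ƛ p) q)    = _ , βl , β-subst-cong p q
simulate-βl (∼⋆sym p (∼ƛ q)) = _ , βr , β-subst-cong q p

simulate-βr : ∀ {M P Q} → M ∼ (Q ⋆ ƛ P) → M ⟶∼ (P [0:= Q ])
simulate-βr (∼⋆ p (∼ƛ q))    = _ , βr , β-subst-cong q p
simulate-βr (∼⋆sym (∼ƛ p) q) = _ , βl , β-subst-cong p q

-- For η, the argument similar to shift 1 P is itself a shift (of P₀ ∼ P).
simulate-ηl : ∀ {M P} → M ∼ ƛ (shift 1 P ⋆ var zero) → M ⟶∼ P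
simulate-ηl {P = P} (∼ƛ (∼⋆ p ∼var)) with rename-reflect suc P p
... | P₀ , refl , a = P₀ , ηl , a
simulate-ηl {P = P} (∼ƛ (∼⋆sym ∼var q)) with rename-reflect suc P q
... | P₀ , refl , a = P₀ , ηr , a

simulate-ηr : ∀ {M P} → M ∼ ƛ (var zero ⋆ shift 1 P) → M ⟶∼ P
simulate-ηr {P = P} (∼ƛ (∼⋆ ∼var q)) with rename-reflect suc P q
... | P₀ , refl , a = P₀ , ηr , a
simulate-ηr {P = P} (∼ƛ (∼⋆sym p ∼var)) with rename-reflect suc P p
... | P₀ , refl , a = P₀ , ηl , a

simulate-πl : ∀ {M i P₁ P₂ Q} → M ∼ (⟨ P₁ , P₂ ⟩ ⋆ σ i Q) → M ⟶∼ (select i P₁ P₂ ⋆ Q)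
simulate-πl (∼⋆ (∼pair p₁ p₂) (∼σ {i = i} q))    = _ , πl , ∼⋆ (select-cong i p₁ p₂) q
simulate-πl (∼⋆sym (∼σ {i = i} q) (∼pair p₁ p₂)) = _ , πr , ∼⋆sym q (select-cong i p₁ p₂)

simulate-πr : ∀ {M i P₁ P₂ Q} → M ∼ (σ i Q ⋆ ⟨ P₁ , P₂ ⟩) → M ⟶∼ (Q ⋆ select i P₁ P₂)
simulate-πr (∼⋆ (∼σ {i = i} q) (∼pair p₁ p₂))    = _ , πr , ∼⋆ q (select-cong i p₁ p₂)
simulate-πr (∼⋆sym (∼pair p₁ p₂) (∼σ {i = i} q)) = _ , πl , ∼⋆sym (select-cong i p₁ p₂) q

ctx-at : ∀ {E P Γ k} → binders E ≡ k → ¬ E ≡ □ →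
         Γ ⊢ plug E (shift k P) ∶ ⊥ₜ → Γ ⊢ P ∶ ⊥ₜ → plug E (shift k P) ⟶ P
ctx-at refl = ctx

-- A term similar to E[P] is E'[P₀] with P₀ ∼ P (by the two reflection
-- lemmas), and erasing E' is an instance of the same rule.
simulate-ctx : ∀ {M E P Γ} → M ∼ plug E (shift (binders E) P) → ¬ E ≡ □ →
               Γ ⊢ plug E (shift (binders E) P) ∶ ⊥ₜ → Γ ⊢ P ∶ ⊥ₜ → M ⟶∼ P
simulate-ctx {E = E} {P} p E≢□ tE tP with plug-reflect E _ p
... | plugged E' Q₀ refl q same nontrivial with rename-reflect (binders E +_) P q
... | P₀ , refl , a =
  P₀ , ctx-at same (nontrivial E≢□)
                   (∼-preserves-typing (∼sym p) tE)
                   (∼-preserves-typing (∼sym a) tP)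
     , a

simulation : ∀ {M M' N} → M ∼ M' → M' ⟶ N → M ⟶∼ N
simulation p βl               = simulate-βl p
simulation p βr               = simulate-βr p
simulation p ηl               = simulate-ηl p
simulation p ηr               = simulate-ηr p
simulation p πl               = simulate-πl p
simulation p πr               = simulate-πr p
simulation p (ctx E≢□ tE tP)  = simulate-ctx p E≢□ tE tP
simulation (∼pair p q) (c-pairˡ r) with simulation p r
... | _ , r' , a = _ , c-pairˡ r' , ∼pair a q
simulation (∼pair p q) (c-pairʳ r) with simulation q r
... | _ , r' , a = _ , c-pairʳ r' , ∼pair p a
simulation (∼σ p) (c-σ r) with simulation p r
... | _ , r' , a = _ , c-σ r' , ∼σ a
simulation (∼ƛ p) (c-ƛ r) with simulation p r
... | _ , r' , a = _ , c-ƛ r' , ∼ƛ a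
simulation (∼⋆ p q) (c-⋆ˡ r) with simulation p r
... | _ , r' , a = _ , c-⋆ˡ r' , ∼⋆ a q
simulation (∼⋆ p q) (c-⋆ʳ r) with simulation q r
... | _ , r' , a = _ , c-⋆ʳ r' , ∼⋆ p a
simulation (∼⋆sym p q) (c-⋆ˡ r) with simulation q r
... | _ , r' , a = _ , c-⋆ʳ r' , ∼⋆sym p a
simulation (∼⋆sym p q) (c-⋆ʳ r) with simulation p r
... | _ , r' , a = _ , c-⋆ˡ r' , ∼⋆sym a q

lemma4p4 : ((x : ℕ) {M M' N N' : Term} → M ∼ M' → N ∼ N' →
             (M [ x := N ]) ∼ (M' [ x := N' ]))
           × ({M M' N : Term} → M ∼ M' → M' ⟶ N →
             Σ Term (λ N' → (M ⟶ N') × (N ∼ N')))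
lemma4p4 = substitution , reduction
  where
  substitution : (x : ℕ) {M M' N N' : Term} → M ∼ M' → N ∼ N' →
                 (M [ x := N ]) ∼ (M' [ x := N' ])
  substitution x p q = subst-cong (:=-cong x q) p

  reduction : {M M' N : Term} → M ∼ M' → M' ⟶ N →
              Σ Term (λ N' → (M ⟶ N') × (N ∼ N'))
  reduction p r with simulation p r
  ... | N' , r' , a = N' , r' , ∼sym a
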